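{- For all closed session types $T,S$: $T\le_s S$ is not derivable if and only if $T\ntriangleleft_s S$ is derivable.
   Context: Session types: $T,S ::= \&_{i\in I}?l_i(S_i).T_i \mid \bigoplus_{i\in I}!l_i\langle S_i\rangle.T_i \mid \mathbf t \mid \mu\mathbf t.T \mid \mathsf{end}$ (branching, selection, type variable, recursion, termination), with pairwise distinct labels in each branching/selection, closed exchanged types $S_i$ and contractive recursion; types are equi-recursive, i.e. identified when they have the same regular tree (so $\mu\mathbf t.T=T\{\mu\mathbf t.T/\mathbf t\}$). Synchronous subtyping $\le_s$ is the largest (coinductively defined) relation on closed types such that $T\le_s S$ implies one of: $T=S=\mathsf{end}$; $T=\&_{i\in I\cup J}?l_i(S_i).T_i$, $S=\&_{i\in I}?l_i(S'_i).T'_i$ with $S_i\le_s S'_i$ and $T_i\le_s T'_i$ for all $i\in I$; $T=\bigoplus_{i\in I}!l_i\langle S_i\rangle.T_i$, $S=\bigoplus_{i\in I\cup J}!l_i\langle S'_i\rangle.T'_i$ with $S'_i\le_s S_i$ and $T_i\le_s T'_i$ for all $i\in I$. The relation $\ntriangleleft_s$ is defined inductively by the rules: $\mathsf{end}\ntriangleleft T$ if $T\ne\mathsf{end}$; $T\ntriangleleft\mathsf{end}$ if $T\ne\mathsf{end}$; $\&_{i\in I}?l_i(S_i).T_i\ntriangleleft\bigoplus_{j\in J}!l'_j\langle S'_j\rangle.T'_j$; $\bigoplus_{j\in J}!l'_j\langle S'_j\rangle.T'_j\ntriangleleft\&_{i\in I}?l_i(S_i).T_i$; $\&_{i\in I}?l_i(S_i).T_i\ntriangleleft\&_{j\in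 J}?l'_j(S'_j).T'_j$ if either (a) $\exists j\in J\,\forall i\in I: l_i\ne l'_j$, or (b) $\exists i\in I,j\in J$ with $l_i=l'_j$ and $S_i\ntriangleleft S'_j$, or (c) $\exists i\in I,j\in J$ with $l_i=l'_j$ and $T_i\ntriangleleft T'_j$; $\bigoplus_{i\in I}!l_i\langle S_i\rangle.T_i\ntriangleleft\bigoplus_{j\in J}!l'_j\langle S'_j\rangle.T'_j$ if either (a) $\exists i\in I\,\forall j\in J: l_i\ne l'_j$, or (b) $\exists i\in I,j\in J$ with $l_i=l'_j$ and $S'_j\ntriangleleft S_i$, or (c) $\exists i\in I,j\in J$ with $l_i=l'_j$ and $T_i\ntriangleleft T'_j$. -}

module Defs where

open import Data.Nat using (ℕ; suc)
open import Data.Fin using (Fin; zero; suc)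
open import Data.List using (List; []; _∷_; map)
open import Data.List.Membership.Propositional using (_∈_)
open import Data.List.Relation.Unary.Unique.Propositional using (Unique)
open import Data.Product using (Σ; _×_; _,_; proj₁; ∃; ∃-syntax)
open import Data.Unit using (⊤)
open import Data.Empty using (⊥)
open import Relation.Binary.PropositionalEquality using (_≡_; _≢_)
open import Relation.Nullary using (¬_)

-- Syntax of session types (de Bruijn indices for recursion variables).
-- Ty n : types with at most n free recursion variables.
-- Exchanged (payload) types are closed, hence of type Ty 0.

Label : Set
Label = ℕ

data Ty : ℕ → Set where
  end : ∀ {n} → Ty n
  var : ∀ {n} → Fin n → Ty n
  rec : ∀ {n} → Ty (suc n) → Ty n
  bra : ∀ {n} → List (Label × Ty 0 × Ty n) → Ty n  -- & { ?l_i(S_i) . T_i }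
  sel : ∀ {n} → List (Label × Ty 0 × Ty n) → Ty n  -- ⊕ { !l_i⟨S_i⟩ . T_i }

Branch : ℕ → Set
Branch n = Label × Ty 0 × Ty n

ext : ∀ {m n} → (Fin m → Fin n) → Fin (suc m) → Fin (suc n)
ext f zero = zero
ext f (suc x) = suc (f x)

mutual
  ren : ∀ {m n} → (Fin m → Fin n) → Ty m → Ty n
  ren f end = end
  ren f (var x) = var (f x)
  ren f (rec T) = rec (ren (ext f) T)
  ren f (bra bs) = bra (renBs f bs)
  ren f (sel bs) = sel (renBs f bs)

  renBs : ∀ {m n} → (Fin m → Fin n) → List (Branch m) → List (Branch n)
  renBs f [] = []
  renBs f ((l , S , T) ∷ bs) = (l , S , ren f T) ∷ renBs f bs

exts : ∀ {m n} → (Fin m → Ty n) → Fin (suc m) → Ty (suc n)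
exts σ zero = var zero
exts σ (suc x) = ren suc (σ x)

mutual
  sub : ∀ {m n} → (Fin m → Ty n) → Ty m → Ty n
  sub σ end = end
  sub σ (var x) = σ x
  sub σ (rec T) = rec (sub (exts σ) T)
  sub σ (bra bs) = bra (subBs σ bs)
  sub σ (sel bs) = sel (subBs σ bs)

  subBs : ∀ {m n} → (Fin m → Ty n) → List (Branch m) → List (Branch n)
  subBs σ [] = []
  subBs σ ((l , S , T) ∷ bs) = (l , S , sub σ T) ∷ subBs σ bs

_[_]₀ : ∀ {n} → Ty (suc n) → Ty n → Ty n
T [ U ]₀ = sub σ T
  where
    σ : _ → _
    σ zero = U
    σ (suc x) = var x

-- Well-formedness: contractive recursion, pairwise distinct labels,
-- (closedness is enforced by using Ty 0; payloads are Ty 0 by construction)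

Unguarded : ∀ {n} → Ty n → Set
Unguarded end = ⊥
Unguarded (var x) = ⊤
Unguarded (rec T) = Unguarded T
Unguarded (bra bs) = ⊥
Unguarded (sel bs) = ⊥

labels : ∀ {n} → List (Branch n) → List Label
labels = map proj₁

mutual
  WF : ∀ {n} → Ty n → Set
  WF end = ⊤
  WF (var x) = ⊤
  WF (rec T) = ¬ Unguarded T × WF T
  WF (bra bs) = Unique (labels bs) × WFBs bs
  WF (sel bs) = Unique (labels bs) × WFBs bs

  WFBs : ∀ {n} → List (Branch n) → Set
  WFBs [] = ⊤
  WFBs ((l , S , T) ∷ bs) = WF S × WF T × WFBs bs

-- Equi-recursive view: a closed type unfolds (finitely many μ-unfoldings
-- μt.T = T{μt.T/t}) to its head constructor.

data Unf : Ty 0 → Ty 0 → Set where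
  u-end : Unf end end
  u-bra : ∀ {bs} → Unf (bra bs) (bra bs)
  u-sel : ∀ {bs} → Unf (sel bs) (sel bs)
  u-rec : ∀ {T H} → Unf (T [ rec T ]₀) H → Unf (rec T) H

-- Synchronous subtyping ≤s : the largest relation R such that R T S implies
-- one of the three clauses (i.e. R is a post-fixed point / simulation).

Rel : Set₁
Rel = Ty 0 → Ty 0 → Set

data SubStep (R : Rel) (T S : Ty 0) : Set where
  s-end : Unf T end → Unf S end → SubStep R T S
  s-bra : ∀ {bs bs'} → Unf T (bra bs) → Unf S (bra bs')
        → (∀ {l S₂ T₂} → (l , S₂ , T₂) ∈ bs'
             → ∃[ S₁ ] ∃[ T₁ ] ((l , S₁ , T₁) ∈ bs × R S₁ S₂ × R T₁ T₂))
        → SubStep R T S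
  s-sel : ∀ {bs bs'} → Unf T (sel bs) → Unf S (sel bs')
        → (∀ {l S₁ T₁} → (l , S₁ , T₁) ∈ bs
             → ∃[ S₂ ] ∃[ T₂ ] ((l , S₂ , T₂) ∈ bs' × R S₂ S₁ × R T₁ T₂))
        → SubStep R T S

IsSubRel : Rel → Set
IsSubRel R = ∀ {T S} → R T S → SubStep R T S

_≤s_ : Ty 0 → Ty 0 → Set₁
T ≤s S = Σ Rel (λ R → IsSubRel R × R T S)

infix 4 _⋪s_ _≤s_

data _⋪s_ : Ty 0 → Ty 0 → Set where
  n-end-l : ∀ {T S} → Unf T end → ¬ Unf S end → T ⋪s S
  n-end-r : ∀ {T S} → ¬ Unf T end → Unf S end → T ⋪s S
  n-bra-sel : ∀ {T S bs bs'} → Unf T (bra bs) → Unf S (sel bs') → T ⋪s S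
  n-sel-bra : ∀ {T S bs bs'} → Unf T (sel bs) → Unf S (bra bs') → T ⋪s S
  n-bra-a : ∀ {T S bs bs' l S₂ T₂} → Unf T (bra bs) → Unf S (bra bs')
          → (l , S₂ , T₂) ∈ bs'
          → (∀ {b} → b ∈ bs → proj₁ b ≢ l)
          → T ⋪s S
  n-bra-b : ∀ {T S bs bs' l S₁ T₁ S₂ T₂} → Unf T (bra bs) → Unf S (bra bs')
          → (l , S₁ , T₁) ∈ bs → (l , S₂ , T₂) ∈ bs'
          → S₁ ⋪s S₂
          → T ⋪s S
  n-bra-c : ∀ {T S bs bs' l S₁ T₁ S₂ T₂} → Unf T (bra bs) → Unf S (bra bs')
          → (l , S₁ , T₁) ∈ bs → (l , S₂ , T₂) ∈ bs'
          → T₁ ⋪s T₂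
          → T ⋪s S
  n-sel-a : ∀ {T S bs bs' l S₁ T₁} → Unf T (sel bs) → Unf S (sel bs')
          → (l , S₁ , T₁) ∈ bs
          → (∀ {b} → b ∈ bs' → l ≢ proj₁ b)
          → T ⋪s S
  n-sel-b : ∀ {T S bs bs' l S₁ T₁ S₂ T₂} → Unf T (sel bs) → Unf S (sel bs')
          → (l , S₁ , T₁) ∈ bs → (l , S₂ , T₂) ∈ bs'
          → S₂ ⋪s S₁
          → T ⋪s S
  n-sel-c : ∀ {T S bs bs' l S₁ T₁ S₂ T₂} → Unf T (sel bs) → Unf S (sel bs')
          → (l , S₁ , T₁) ∈ bs → (l , S₂ , T₂) ∈ bs'
          → T₁ ⋪s T₂
          → T ⋪s S

-- Soundness: a derivation of T ⋪s S and a simulation containing (T , S)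
-- cannot coexist. Follow the derivation: at each step the simulation offers a
-- matching pair of branches, and since labels are distinct it is the very pair
-- the derivation continues with, until a rule with no premise contradicts the
-- simulation outright.
--
-- Completeness: let T ⋪[ k ] S mean that T ⋪s S has a derivation of height at
-- most k. These approximants are decidable and grow with k. Every type reached
-- from T or S by unfolding and taking branches is an instance of a subterm of T
-- or S whose free variables are instantiated by their binders, so only finitely
-- many pairs of types matter; on them the approximants stabilise at some k.
-- At that k the complement of ⋪[ k ] is closed under the clauses of ≤s, so
-- either T ⋪[ k ] S or it is a simulation containing (T , S).

module Submission where

open import Defs
open import Data.Nat using (ℕ; zero; suc; _≤_; _≟_; z≤n; s≤s)
open import Data.Nat.Properties using (≤-trans; ≤∧≢⇒<; <-irrefl; m≤n⇒m≤1+n; suc-injective)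
open import Data.Fin using (Fin; zero; suc)
open import Data.List using (List; []; _∷_; _++_; length; cartesianProduct)
open import Data.List.Relation.Unary.Any using (here; there)
open import Data.List.Relation.Unary.All as All using (All; []; _∷_)
open import Data.List.Relation.Unary.All.Properties using (map⁻)
open import Data.List.Relation.Unary.AllPairs using (_∷_)
open import Data.List.Relation.Unary.Unique.Propositional using (Unique)
open import Data.List.Relation.Binary.Subset.Propositional using (_⊆_)
open import Data.List.Membership.Propositional using (_∈_)
open import Data.List.Membership.Propositional.Properties
  using (∈-++⁺ˡ; ∈-++⁺ʳ; ∈-++⁻; ∈-cartesianProduct⁺; ∈-cartesianProduct⁻)
open import Data.Product using (_×_; _,_; proj₁; proj₂; ∃; ∃-syntax)
open import Data.Sum using (_⊎_; inj₁; inj₂)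
open import Data.Unit using (⊤; tt)
open import Data.Empty using (⊥; ⊥-elim)
import Data.Vec.Functional as Env
open import Function using (_∘_; flip)
open import Function.Bundles using (_⇔_; mk⇔)
open import Relation.Nullary using (¬_; Dec; yes; no)
open import Relation.Nullary.Decidable using (map′; ¬?; _×-dec_; _⊎-dec_)
open import Relation.Binary.PropositionalEquality

cong-branch : ∀ {n} {l : Label} {S : Ty 0} {T T′ : Ty n} {bs bs′ : List (Branch n)} →
              T ≡ T′ → bs ≡ bs′ → (l , S , T) ∷ bs ≡ (l , S , T′) ∷ bs′
cong-branch refl refl = refl

ext-cong : ∀ {m n} {f g : Fin m → Fin n} → f ≗ g → ext f ≗ ext g
ext-cong f≗g zero = refl
ext-cong f≗g (suc x) = cong suc (f≗g x)

exts-cong : ∀ {m n} {σ τ : Fin m → Ty n} → σ ≗ τ → exts σ ≗ exts τ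
exts-cong σ≗τ zero = refl
exts-cong σ≗τ (suc x) = cong (ren suc) (σ≗τ x)

mutual
  ren-cong : ∀ {m n} {f g : Fin m → Fin n} → f ≗ g → ∀ T → ren f T ≡ ren g T
  ren-cong e end = refl
  ren-cong e (var x) = cong var (e x)
  ren-cong e (rec T) = cong rec (ren-cong (ext-cong e) T)
  ren-cong e (bra bs) = cong bra (renBs-cong e bs)
  ren-cong e (sel bs) = cong sel (renBs-cong e bs)

  renBs-cong : ∀ {m n} {f g : Fin m → Fin n} → f ≗ g → ∀ bs → renBs f bs ≡ renBs g bs
  renBs-cong e [] = refl
  renBs-cong e ((l , S , T) ∷ bs) = cong-branch (ren-cong e T) (renBs-cong e bs)

mutual
  sub-cong : ∀ {m n} {σ τ : Fin m → Ty n} → σ ≗ τ → ∀ T → sub σ T ≡ sub τ T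
  sub-cong e end = refl
  sub-cong e (var x) = e x
  sub-cong e (rec T) = cong rec (sub-cong (exts-cong e) T)
  sub-cong e (bra bs) = cong bra (subBs-cong e bs)
  sub-cong e (sel bs) = cong sel (subBs-cong e bs)

  subBs-cong : ∀ {m n} {σ τ : Fin m → Ty n} → σ ≗ τ → ∀ bs → subBs σ bs ≡ subBs τ bs
  subBs-cong e [] = refl
  subBs-cong e ((l , S , T) ∷ bs) = cong-branch (sub-cong e T) (subBs-cong e bs)

ext-∘ : ∀ {m n p} (f : Fin m → Fin n) (g : Fin n → Fin p) → ext g ∘ ext f ≗ ext (g ∘ f)
ext-∘ f g zero = refl
ext-∘ f g (suc x) = refl

mutual
  ren-ren : ∀ {m n p} (f : Fin m → Fin n) (g : Fin n → Fin p) T →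
            ren g (ren f T) ≡ ren (g ∘ f) T
  ren-ren f g end = refl
  ren-ren f g (var x) = refl
  ren-ren f g (rec T) = cong rec (trans (ren-ren (ext f) (ext g) T) (ren-cong (ext-∘ f g) T))
  ren-ren f g (bra bs) = cong bra (renBs-renBs f g bs)
  ren-ren f g (sel bs) = cong sel (renBs-renBs f g bs)

  renBs-renBs : ∀ {m n p} (f : Fin m → Fin n) (g : Fin n → Fin p) bs →
                renBs g (renBs f bs) ≡ renBs (g ∘ f) bs
  renBs-renBs f g [] = refl
  renBs-renBs f g ((l , S , T) ∷ bs) = cong-branch (ren-ren f g T) (renBs-renBs f g bs)

exts-ext : ∀ {m n p} (f : Fin m → Fin n) (τ : Fin n → Ty p) → exts τ ∘ ext f ≗ exts (τ ∘ f)
exts-ext f τ zero = refl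
exts-ext f τ (suc x) = refl

mutual
  sub-ren : ∀ {m n p} (f : Fin m → Fin n) (τ : Fin n → Ty p) T →
            sub τ (ren f T) ≡ sub (τ ∘ f) T
  sub-ren f τ end = refl
  sub-ren f τ (var x) = refl
  sub-ren f τ (rec T) = cong rec (trans (sub-ren (ext f) (exts τ) T) (sub-cong (exts-ext f τ) T))
  sub-ren f τ (bra bs) = cong bra (subBs-renBs f τ bs)
  sub-ren f τ (sel bs) = cong sel (subBs-renBs f τ bs)

  subBs-renBs : ∀ {m n p} (f : Fin m → Fin n) (τ : Fin n → Ty p) bs →
                subBs τ (renBs f bs) ≡ subBs (τ ∘ f) bs
  subBs-renBs f τ [] = refl
  subBs-renBs f τ ((l , S , T) ∷ bs) = cong-branch (sub-ren f τ T) (subBs-renBs f τ bs)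

ren-exts : ∀ {m n p} (σ : Fin m → Ty n) (f : Fin n → Fin p) →
           ren (ext f) ∘ exts σ ≗ exts (ren f ∘ σ)
ren-exts σ f zero = refl
ren-exts σ f (suc x) = trans (ren-ren suc (ext f) (σ x)) (sym (ren-ren f suc (σ x)))

mutual
  ren-sub : ∀ {m n p} (σ : Fin m → Ty n) (f : Fin n → Fin p) T →
            ren f (sub σ T) ≡ sub (ren f ∘ σ) T
  ren-sub σ f end = refl
  ren-sub σ f (var x) = refl
  ren-sub σ f (rec T) = cong rec (trans (ren-sub (exts σ) (ext f) T) (sub-cong (ren-exts σ f) T))
  ren-sub σ f (bra bs) = cong bra (renBs-subBs σ f bs)
  ren-sub σ f (sel bs) = cong sel (renBs-subBs σ f bs)

  renBs-subBs : ∀ {m n p} (σ : Fin m → Ty n) (f : Fin n → Fin p) bs →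
                renBs f (subBs σ bs) ≡ subBs (ren f ∘ σ) bs
  renBs-subBs σ f [] = refl
  renBs-subBs σ f ((l , S , T) ∷ bs) = cong-branch (ren-sub σ f T) (renBs-subBs σ f bs)

sub-exts : ∀ {m n p} (σ : Fin m → Ty n) (τ : Fin n → Ty p) →
           sub (exts τ) ∘ exts σ ≗ exts (sub τ ∘ σ)
sub-exts σ τ zero = refl
sub-exts σ τ (suc x) = trans (sub-ren suc (exts τ) (σ x)) (sym (ren-sub τ suc (σ x)))

mutual
  sub-sub : ∀ {m n p} (σ : Fin m → Ty n) (τ : Fin n → Ty p) T →
            sub τ (sub σ T) ≡ sub (sub τ ∘ σ) T
  sub-sub σ τ end = refl
  sub-sub σ τ (var x) = refl
  sub-sub σ τ (rec T) = cong rec (trans (sub-sub (exts σ) (exts τ) T) (sub-cong (sub-exts σ τ) T))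
  sub-sub σ τ (bra bs) = cong bra (subBs-subBs σ τ bs)
  sub-sub σ τ (sel bs) = cong sel (subBs-subBs σ τ bs)

  subBs-subBs : ∀ {m n p} (σ : Fin m → Ty n) (τ : Fin n → Ty p) bs →
                subBs τ (subBs σ bs) ≡ subBs (sub τ ∘ σ) bs
  subBs-subBs σ τ [] = refl
  subBs-subBs σ τ ((l , S , T) ∷ bs) = cong-branch (sub-sub σ τ T) (subBs-subBs σ τ bs)

exts-var : ∀ {n} {σ : Fin n → Ty n} → σ ≗ var → exts σ ≗ var
exts-var e zero = refl
exts-var e (suc x) = cong (ren suc) (e x)

mutual
  sub-var : ∀ {n} {σ : Fin n → Ty n} → σ ≗ var → ∀ T → sub σ T ≡ T
  sub-var e end = refl
  sub-var e (var x) = e x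
  sub-var e (rec T) = cong rec (sub-var (exts-var e) T)
  sub-var e (bra bs) = cong bra (subBs-var e bs)
  sub-var e (sel bs) = cong sel (subBs-var e bs)

  subBs-var : ∀ {n} {σ : Fin n → Ty n} → σ ≗ var → ∀ bs → subBs σ bs ≡ bs
  subBs-var e [] = refl
  subBs-var e ((l , S , T) ∷ bs) = cong-branch (sub-var e T) (subBs-var e bs)

sub-closed : (σ : Fin 0 → Ty 0) (T : Ty 0) → sub σ T ≡ T
sub-closed σ = sub-var (λ ())

unfold-sub : ∀ {k} (ρ : Fin k → Ty 0) (U : Ty (suc k)) →
             sub (exts ρ) U [ sub ρ (rec U) ]₀ ≡ sub (sub ρ (rec U) Env.∷ ρ) U
unfold-sub ρ U = trans (sub-sub (exts ρ) _ U) (sub-cong instantiate U)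
  where
    instantiate : _ ≗ (sub ρ (rec U) Env.∷ ρ)
    instantiate zero = refl
    instantiate (suc x) = trans (sub-ren suc _ (ρ x)) (sub-closed _ (ρ x))

Unguarded-ren : ∀ {m n} (f : Fin m → Fin n) T → Unguarded (ren f T) → Unguarded T
Unguarded-ren f (var x) _ = tt
Unguarded-ren f (rec T) u = Unguarded-ren (ext f) T u

Unguarded-sub : ∀ {m n} (σ : Fin m → Ty n) T → Unguarded (sub σ T) → Unguarded T
Unguarded-sub σ (var x) _ = tt
Unguarded-sub σ (rec T) u = Unguarded-sub (exts σ) T u

labels-renBs : ∀ {m n} (f : Fin m → Fin n) bs → labels (renBs f bs) ≡ labels bs
labels-renBs f [] = refl
labels-renBs f ((l , _) ∷ bs) = cong (l ∷_) (labels-renBs f bs)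

labels-subBs : ∀ {m n} (σ : Fin m → Ty n) bs → labels (subBs σ bs) ≡ labels bs
labels-subBs σ [] = refl
labels-subBs σ ((l , _) ∷ bs) = cong (l ∷_) (labels-subBs σ bs)

mutual
  WF-ren : ∀ {m n} (f : Fin m → Fin n) T → WF T → WF (ren f T)
  WF-ren f end _ = tt
  WF-ren f (var x) _ = tt
  WF-ren f (rec T) (g , w) = g ∘ Unguarded-ren (ext f) T , WF-ren (ext f) T w
  WF-ren f (bra bs) (u , w) = subst Unique (sym (labels-renBs f bs)) u , WFBs-renBs f bs w
  WF-ren f (sel bs) (u , w) = subst Unique (sym (labels-renBs f bs)) u , WFBs-renBs f bs w

  WFBs-renBs : ∀ {m n} (f : Fin m → Fin n) bs → WFBs bs → WFBs (renBs f bs)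
  WFBs-renBs f [] _ = tt
  WFBs-renBs f ((l , S , T) ∷ bs) (wS , wT , w) = wS , WF-ren f T wT , WFBs-renBs f bs w

mutual
  WF-sub : ∀ {m n} (σ : Fin m → Ty n) → (∀ x → WF (σ x)) → ∀ T → WF T → WF (sub σ T)
  WF-sub σ wσ end _ = tt
  WF-sub σ wσ (var x) _ = wσ x
  WF-sub σ wσ (rec T) (g , w) = g ∘ Unguarded-sub (exts σ) T , WF-sub (exts σ) wexts T w
    where
      wexts : ∀ x → WF (exts σ x)
      wexts zero = tt
      wexts (suc x) = WF-ren suc (σ x) (wσ x)
  WF-sub σ wσ (bra bs) (u , w) = subst Unique (sym (labels-subBs σ bs)) u , WFBs-subBs σ wσ bs w
  WF-sub σ wσ (sel bs) (u , w) = subst Unique (sym (labels-subBs σ bs)) u , WFBs-subBs σ wσ bs w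

  WFBs-subBs : ∀ {m n} (σ : Fin m → Ty n) → (∀ x → WF (σ x)) → ∀ bs → WFBs bs → WFBs (subBs σ bs)
  WFBs-subBs σ wσ [] _ = tt
  WFBs-subBs σ wσ ((l , S , T) ∷ bs) (wS , wT , w) = wS , WF-sub σ wσ T wT , WFBs-subBs σ wσ bs w

WF-unfold : ∀ {n} (T : Ty (suc n)) → WF (rec T) → WF (T [ rec T ]₀)
WF-unfold T w = WF-sub _ instantiate T (proj₂ w)
  where
    instantiate : ∀ x → WF _
    instantiate zero = w
    instantiate (suc x) = tt

branch-WF : ∀ {n} {bs : List (Branch n)} {l S T} → WFBs bs → (l , S , T) ∈ bs → WF S × WF T
branch-WF {bs = _ ∷ _} (wS , wT , _) (here refl) = wS , wT
branch-WF {bs = _ ∷ _} (_ , _ , w) (there m) = branch-WF w m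

unique-branch : ∀ {n} {bs : List (Branch n)} {l S T S′ T′} → Unique (labels bs) →
                (l , S , T) ∈ bs → (l , S′ , T′) ∈ bs → S ≡ S′ × T ≡ T′
unique-branch _ (here refl) (here refl) = refl , refl
unique-branch (l∉ ∷ _) (here refl) (there m) = ⊥-elim (All.lookup (map⁻ l∉) m refl)
unique-branch (l∉ ∷ _) (there m) (here refl) = ⊥-elim (All.lookup (map⁻ l∉) m refl)
unique-branch (_ ∷ u) (there m) (there m′) = unique-branch u m m′

μ-depth : ∀ {n} → Ty n → ℕ
μ-depth (rec T) = suc (μ-depth T)
μ-depth _ = 0

μ-depth-sub : ∀ {m n} (σ : Fin m → Ty n) T → ¬ Unguarded T → μ-depth (sub σ T) ≡ μ-depth T
μ-depth-sub σ end _ = refl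
μ-depth-sub σ (var x) g = ⊥-elim (g tt)
μ-depth-sub σ (rec T) g = cong suc (μ-depth-sub (exts σ) T g)
μ-depth-sub σ (bra bs) _ = refl
μ-depth-sub σ (sel bs) _ = refl

-- Contractiveness makes each unfolding strip one leading μ.
unfold-bounded : ∀ n (T : Ty 0) → μ-depth T ≡ n → WF T → ∃ (Unf T)
unfold-bounded _ end _ _ = end , u-end
unfold-bounded _ (bra bs) _ _ = bra bs , u-bra
unfold-bounded _ (sel bs) _ _ = sel bs , u-sel
unfold-bounded (suc n) (rec T) d w@(g , _)
  with unfold-bounded n (T [ rec T ]₀) (trans (μ-depth-sub _ T g) (suc-injective d)) (WF-unfold T w)
... | H , u = H , u-rec u

unfold : (T : Ty 0) → WF T → ∃ (Unf T)
unfold T = unfold-bounded (μ-depth T) T refl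

Unf-functional : ∀ {T H H′} → Unf T H → Unf T H′ → H ≡ H′
Unf-functional u-end u-end = refl
Unf-functional u-bra u-bra = refl
Unf-functional u-sel u-sel = refl
Unf-functional (u-rec u) (u-rec u′) = Unf-functional u u′

¬Unf-end : ∀ {T H} → Unf T H → H ≢ end → ¬ Unf T end
¬Unf-end u H≢end u′ = H≢end (Unf-functional u u′)

Unf-WF : ∀ {T H} → Unf T H → WF T → WF H
Unf-WF u-end w = w
Unf-WF u-bra w = w
Unf-WF u-sel w = w
Unf-WF (u-rec {T} u) w = Unf-WF u (WF-unfold T w)

data Head : Ty 0 → Set where
  end : Head end
  bra : ∀ bs → Head (bra bs)
  sel : ∀ bs → Head (sel bs)

Unf-head : ∀ {T H} → Unf T H → Head H
Unf-head u-end = end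
Unf-head (u-bra {bs}) = bra bs
Unf-head (u-sel {bs}) = sel bs
Unf-head (u-rec u) = Unf-head u

Covered : Rel → Rel → List (Branch 0) → List (Branch 0) → Set
Covered Rp Rc bs bs′ =
  ∀ {l S′ T′} → (l , S′ , T′) ∈ bs′ → ∃[ S ] ∃[ T ] ((l , S , T) ∈ bs × Rp S S′ × Rc T T′)

data Uncovered (Pp Pc : Rel) (bs bs′ : List (Branch 0)) : Set where
  missing : ∀ {l S′ T′} → (l , S′ , T′) ∈ bs′ → (∀ {b} → b ∈ bs → proj₁ b ≢ l) →
            Uncovered Pp Pc bs bs′
  payload : ∀ {l S T S′ T′} → (l , S , T) ∈ bs → (l , S′ , T′) ∈ bs′ → Pp S S′ →
            Uncovered Pp Pc bs bs′
  continuation : ∀ {l S T S′ T′} → (l , S , T) ∈ bs → (l , S′ , T′) ∈ bs′ → Pc T T′ →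
                 Uncovered Pp Pc bs bs′

∁₂ : Rel → Rel
∁₂ P X Y = ¬ P X Y

Uncovered-map : ∀ {Pp Pc Qp Qc bs bs′} →
                (∀ {X Y} → Pp X Y → Qp X Y) → (∀ {X Y} → Pc X Y → Qc X Y) →
                Uncovered Pp Pc bs bs′ → Uncovered Qp Qc bs bs′
Uncovered-map f g (missing m′ ∉) = missing m′ ∉
Uncovered-map f g (payload m m′ p) = payload m m′ (f p)
Uncovered-map f g (continuation m m′ p) = continuation m m′ (g p)

Covered⇒present : ∀ {Rp Rc bs bs′ l S′ T′} → Covered Rp Rc bs bs′ → (l , S′ , T′) ∈ bs′ →
                  ¬ (∀ {b} → b ∈ bs → proj₁ b ≢ l)
Covered⇒present cov m′ ∉ with cov m′
... | _ , _ , m , _ = ∉ m refl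

Covered-at : ∀ {Rp Rc bs bs′ l S T S′ T′} → Unique (labels bs) → Covered Rp Rc bs bs′ →
             (l , S , T) ∈ bs → (l , S′ , T′) ∈ bs′ → Rp S S′ × Rc T T′
Covered-at uniq cov m m′ with cov m′
... | _ , _ , m″ , p , c with refl , refl ← unique-branch uniq m m″ = p , c

∃∈? : ∀ {A : Set} {P : A → Set} (xs : List A) → (∀ {x} → x ∈ xs → Dec (P x)) →
      Dec (∃[ x ] x ∈ xs × P x)
∃∈? [] P? = no λ ()
∃∈? (x ∷ xs) P? with P? (here refl) | ∃∈? xs (P? ∘ there)
... | yes p | _ = yes (x , here refl , p)
... | no _ | yes (y , m , p) = yes (y , there m , p)
... | no ¬p | no ∄ = no λ { (_ , here refl , p) → ¬p p ; (y , there m , p) → ∄ (y , m , p) }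

¬Uncovered⇒Covered : ∀ {Pp Pc bs bs′} → ¬ Uncovered Pp Pc bs bs′ → Covered (∁₂ Pp) (∁₂ Pc) bs bs′
¬Uncovered⇒Covered {bs = bs} ¬u {l} m′ with ∃∈? bs (λ {b} _ → proj₁ b ≟ l)
... | yes ((_ , S , T) , m , refl) =
  S , T , m , ¬u ∘ payload m m′ , ¬u ∘ continuation m m′
... | no ∄ = ⊥-elim (¬u (missing m′ λ m e → ∄ (_ , m , e)))

DecidableOnWF : Rel → Set
DecidableOnWF P = ∀ {X Y} → WF X → WF Y → Dec (P X Y)

uncovered? : ∀ {Pp Pc bs bs′} → DecidableOnWF Pp → DecidableOnWF Pc → WFBs bs → WFBs bs′ →
             Dec (Uncovered Pp Pc bs bs′)
uncovered? {Pp} {Pc} {bs} {bs′} Pp? Pc? w w′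
  with ∃∈? bs′ (λ {b′} _ → ¬? (∃∈? bs (λ {b} _ → proj₁ b ≟ proj₁ b′)))
... | yes (_ , m′ , ∄) = yes (missing m′ λ m e → ∄ (_ , m , e))
... | no all-present with ∃∈? bs (λ m → ∃∈? bs′ (λ m′ → mismatch? m m′))
  where
    mismatch? : ∀ {b b′} → b ∈ bs → b′ ∈ bs′ →
                Dec (proj₁ b ≡ proj₁ b′ × (Pp (proj₁ (proj₂ b)) (proj₁ (proj₂ b′))
                                         ⊎ Pc (proj₂ (proj₂ b)) (proj₂ (proj₂ b′))))
    mismatch? m m′ = (_ ≟ _) ×-dec (Pp? (proj₁ (branch-WF w m)) (proj₁ (branch-WF w′ m′))
                                  ⊎-dec Pc? (proj₂ (branch-WF w m)) (proj₂ (branch-WF w′ m′)))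
...   | yes (_ , m , _ , m′ , refl , inj₁ p) = yes (payload m m′ p)
...   | yes (_ , m , _ , m′ , refl , inj₂ c) = yes (continuation m m′ c)
...   | no ∄ = no λ
  { (missing m′ ∉) → all-present (_ , m′ , λ (_ , m , e) → ∉ m e)
  ; (payload m m′ p) → ∄ (_ , m , _ , m′ , refl , inj₁ p)
  ; (continuation m m′ c) → ∄ (_ , m , _ , m′ , refl , inj₂ c) }

-- For selection the
-- supertype's branches cover the subtype's, so the lists swap places and the
-- continuation relation is flipped back to stay covariant.

data HeadStep (R : Rel) : Rel where
  end≤end : HeadStep R end end
  bra≤bra : ∀ {bs bs′} → Covered R R bs bs′ → HeadStep R (bra bs) (bra bs′)
  sel≤sel : ∀ {bs bs′} → Covered R (flip R) bs′ bs → HeadStep R (sel bs) (sel bs′)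

data Clash (P : Rel) : Rel where
  end⋪bra : ∀ {bs} → Clash P end (bra bs)
  end⋪sel : ∀ {bs} → Clash P end (sel bs)
  bra⋪end : ∀ {bs} → Clash P (bra bs) end
  sel⋪end : ∀ {bs} → Clash P (sel bs) end
  bra⋪sel : ∀ {bs bs′} → Clash P (bra bs) (sel bs′)
  sel⋪bra : ∀ {bs bs′} → Clash P (sel bs) (bra bs′)
  bra⋪bra : ∀ {bs bs′} → Uncovered P P bs bs′ → Clash P (bra bs) (bra bs′)
  sel⋪sel : ∀ {bs bs′} → Uncovered P (flip P) bs′ bs → Clash P (sel bs) (sel bs′)

SubStep⇒HeadStep : ∀ {R T S H₁ H₂} → SubStep R T S → Unf T H₁ → Unf S H₂ → HeadStep R H₁ H₂
SubStep⇒HeadStep (s-end a a′) u u′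
  with refl ← Unf-functional a u | refl ← Unf-functional a′ u′ = end≤end
SubStep⇒HeadStep (s-bra a a′ cov) u u′
  with refl ← Unf-functional a u | refl ← Unf-functional a′ u′ = bra≤bra cov
SubStep⇒HeadStep (s-sel a a′ cov) u u′
  with refl ← Unf-functional a u | refl ← Unf-functional a′ u′ = sel≤sel cov

HeadStep⇒SubStep : ∀ {R T S H₁ H₂} → Unf T H₁ → Unf S H₂ → HeadStep R H₁ H₂ → SubStep R T S
HeadStep⇒SubStep u u′ end≤end = s-end u u′
HeadStep⇒SubStep u u′ (bra≤bra cov) = s-bra u u′ cov
HeadStep⇒SubStep u u′ (sel≤sel cov) = s-sel u u′ cov

Clash-map : ∀ {P Q} → (∀ {X Y} → P X Y → Q X Y) → ∀ {H₁ H₂} → Clash P H₁ H₂ → Clash Q H₁ H₂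
Clash-map f end⋪bra = end⋪bra
Clash-map f end⋪sel = end⋪sel
Clash-map f bra⋪end = bra⋪end
Clash-map f sel⋪end = sel⋪end
Clash-map f bra⋪sel = bra⋪sel
Clash-map f sel⋪bra = sel⋪bra
Clash-map f (bra⋪bra u) = bra⋪bra (Uncovered-map f f u)
Clash-map f (sel⋪sel u) = sel⋪sel (Uncovered-map f f u)

Clash⇒⋪s : ∀ {P T S H₁ H₂} → (∀ {X Y} → P X Y → X ⋪s Y) →
           Unf T H₁ → Unf S H₂ → Clash P H₁ H₂ → T ⋪s S
Clash⇒⋪s f u u′ end⋪bra = n-end-l u (¬Unf-end u′ λ ())
Clash⇒⋪s f u u′ end⋪sel = n-end-l u (¬Unf-end u′ λ ())
Clash⇒⋪s f u u′ bra⋪end = n-end-r (¬Unf-end u λ ()) u′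
Clash⇒⋪s f u u′ sel⋪end = n-end-r (¬Unf-end u λ ()) u′
Clash⇒⋪s f u u′ bra⋪sel = n-bra-sel u u′
Clash⇒⋪s f u u′ sel⋪bra = n-sel-bra u u′
Clash⇒⋪s f u u′ (bra⋪bra (missing m′ ∉)) = n-bra-a u u′ m′ ∉
Clash⇒⋪s f u u′ (bra⋪bra (payload m m′ p)) = n-bra-b u u′ m m′ (f p)
Clash⇒⋪s f u u′ (bra⋪bra (continuation m m′ p)) = n-bra-c u u′ m m′ (f p)
Clash⇒⋪s f u u′ (sel⋪sel (missing m ∉)) = n-sel-a u u′ m (≢-sym ∘ ∉)
Clash⇒⋪s f u u′ (sel⋪sel (payload m′ m p)) = n-sel-b u u′ m m′ (f p)
Clash⇒⋪s f u u′ (sel⋪sel (continuation m′ m p)) = n-sel-c u u′ m m′ (f p)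

¬Clash⇒HeadStep : ∀ {P H₁ H₂} → Head H₁ → Head H₂ → ¬ Clash P H₁ H₂ → HeadStep (∁₂ P) H₁ H₂
¬Clash⇒HeadStep end end _ = end≤end
¬Clash⇒HeadStep (bra _) (bra _) ¬c = bra≤bra (¬Uncovered⇒Covered (¬c ∘ bra⋪bra))
¬Clash⇒HeadStep (sel _) (sel _) ¬c = sel≤sel (¬Uncovered⇒Covered (¬c ∘ sel⋪sel))
¬Clash⇒HeadStep end (bra _) ¬c = ⊥-elim (¬c end⋪bra)
¬Clash⇒HeadStep end (sel _) ¬c = ⊥-elim (¬c end⋪sel)
¬Clash⇒HeadStep (bra _) end ¬c = ⊥-elim (¬c bra⋪end)
¬Clash⇒HeadStep (sel _) end ¬c = ⊥-elim (¬c sel⋪end)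
¬Clash⇒HeadStep (bra _) (sel _) ¬c = ⊥-elim (¬c bra⋪sel)
¬Clash⇒HeadStep (sel _) (bra _) ¬c = ⊥-elim (¬c sel⋪bra)

clash? : ∀ {P H₁ H₂} → DecidableOnWF P → Head H₁ → Head H₂ → WF H₁ → WF H₂ → Dec (Clash P H₁ H₂)
clash? P? end end _ _ = no λ ()
clash? P? end (bra _) _ _ = yes end⋪bra
clash? P? end (sel _) _ _ = yes end⋪sel
clash? P? (bra _) end _ _ = yes bra⋪end
clash? P? (sel _) end _ _ = yes sel⋪end
clash? P? (bra _) (sel _) _ _ = yes bra⋪sel
clash? P? (sel _) (bra _) _ _ = yes sel⋪bra
clash? P? (bra _) (bra _) (_ , w) (_ , w′) =
  map′ bra⋪bra (λ { (bra⋪bra u) → u }) (uncovered? P? P? w w′)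
clash? P? (sel _) (sel _) (_ , w) (_ , w′) =
  map′ sel⋪sel (λ { (sel⋪sel u) → u }) (uncovered? P? (flip P?) w′ w)

⋪s-sound : ∀ {R T S} → IsSubRel R → R T S → WF T → WF S → ¬ T ⋪s S
⋪s-sound isR r wT wS (n-end-l u ¬u′) with unfold _ wS
... | _ , u′ with SubStep⇒HeadStep (isR r) u u′
... | end≤end = ¬u′ u′
⋪s-sound isR r wT wS (n-end-r ¬u u′) with unfold _ wT
... | _ , u with SubStep⇒HeadStep (isR r) u u′
... | end≤end = ¬u u
⋪s-sound isR r wT wS (n-bra-sel u u′) with SubStep⇒HeadStep (isR r) u u′
... | ()
⋪s-sound isR r wT wS (n-sel-bra u u′) with SubStep⇒HeadStep (isR r) u u′
... | ()
⋪s-sound isR r wT wS (n-bra-a u u′ m′ ∉) with SubStep⇒HeadStep (isR r) u u′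
... | bra≤bra cov = Covered⇒present cov m′ ∉
⋪s-sound isR r wT wS (n-sel-a u u′ m ∉) with SubStep⇒HeadStep (isR r) u u′
... | sel≤sel cov = Covered⇒present cov m (≢-sym ∘ ∉)
⋪s-sound isR r wT wS (n-bra-b u u′ m m′ p)
  with SubStep⇒HeadStep (isR r) u u′ | Unf-WF u wT | Unf-WF u′ wS
... | bra≤bra cov | uniq , w | _ , w′ =
  ⋪s-sound isR (proj₁ (Covered-at uniq cov m m′)) (proj₁ (branch-WF w m)) (proj₁ (branch-WF w′ m′)) p
⋪s-sound isR r wT wS (n-bra-c u u′ m m′ p)
  with SubStep⇒HeadStep (isR r) u u′ | Unf-WF u wT | Unf-WF u′ wS
... | bra≤bra cov | uniq , w | _ , w′ =
  ⋪s-sound isR (proj₂ (Covered-at uniq cov m m′)) (proj₂ (branch-WF w m)) (proj₂ (branch-WF w′ m′)) p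
⋪s-sound isR r wT wS (n-sel-b u u′ m m′ p)
  with SubStep⇒HeadStep (isR r) u u′ | Unf-WF u wT | Unf-WF u′ wS
... | sel≤sel cov | _ , w | uniq′ , w′ =
  ⋪s-sound isR (proj₁ (Covered-at uniq′ cov m′ m)) (proj₁ (branch-WF w′ m′)) (proj₁ (branch-WF w m)) p
⋪s-sound isR r wT wS (n-sel-c u u′ m m′ p)
  with SubStep⇒HeadStep (isR r) u u′ | Unf-WF u wT | Unf-WF u′ wS
... | sel≤sel cov | _ , w | uniq′ , w′ =
  ⋪s-sound isR (proj₂ (Covered-at uniq′ cov m′ m)) (proj₂ (branch-WF w m)) (proj₂ (branch-WF w′ m′)) p

_⋪[_]_ : Ty 0 → ℕ → Ty 0 → Set
T ⋪[ zero ] S = ⊥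
T ⋪[ suc k ] S = ∃[ H₁ ] ∃[ H₂ ] (Unf T H₁ × Unf S H₂ × Clash _⋪[ k ]_ H₁ H₂)

⋪[]-mono : ∀ k {T S} → T ⋪[ k ] S → T ⋪[ suc k ] S
⋪[]-mono (suc k) (H₁ , H₂ , u , u′ , c) = H₁ , H₂ , u , u′ , Clash-map (⋪[]-mono k) c

⋪[]⇒⋪s : ∀ k {T S} → T ⋪[ k ] S → T ⋪s S
⋪[]⇒⋪s (suc k) (_ , _ , u , u′ , c) = Clash⇒⋪s (⋪[]⇒⋪s k) u u′ c

⋪[_]? : ∀ k → DecidableOnWF _⋪[ k ]_
⋪[ zero ]? _ _ = no λ ()
⋪[ suc k ]? {T} {S} wT wS with unfold T wT | unfold S wS
... | H₁ , u | H₂ , u′ =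
  map′ (λ c → H₁ , H₂ , u , u′ , c)
       (λ (_ , _ , v , v′ , c) → subst₂ (Clash _⋪[ k ]_) (Unf-functional v u) (Unf-functional v′ u′) c)
       (clash? ⋪[ k ]? (Unf-head u) (Unf-head u′) (Unf-WF u wT) (Unf-WF u′ wS))

mutual
  subterms : ∀ {k} → (Fin k → Ty 0) → Ty k → List (Ty 0)
  subterms ρ U = sub ρ U ∷ properSubterms ρ U

  properSubterms : ∀ {k} → (Fin k → Ty 0) → Ty k → List (Ty 0)
  properSubterms ρ end = []
  properSubterms ρ (var x) = []
  properSubterms ρ (rec U) = subterms (sub ρ (rec U) Env.∷ ρ) U
  properSubterms ρ (bra bs) = branchSubterms ρ bs
  properSubterms ρ (sel bs) = branchSubterms ρ bs

  branchSubterms : ∀ {k} → (Fin k → Ty 0) → List (Branch k) → List (Ty 0)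
  branchSubterms ρ [] = []
  branchSubterms ρ ((l , S , T) ∷ bs) = subterms Env.[] S ++ subterms ρ T ++ branchSubterms ρ bs

ChildrenIn : List (Ty 0) → Ty 0 → Set
ChildrenIn L end = ⊤
ChildrenIn L (var ())
ChildrenIn L (rec V) = V [ rec V ]₀ ∈ L
ChildrenIn L (bra bs) = ∀ {l S T} → (l , S , T) ∈ bs → S ∈ L × T ∈ L
ChildrenIn L (sel bs) = ∀ {l S T} → (l , S , T) ∈ bs → S ∈ L × T ∈ L

Closed : List (Ty 0) → Set
Closed L = ∀ {X} → X ∈ L → ChildrenIn L X

Unf-∈ : ∀ {L X H} → Closed L → X ∈ L → Unf X H → H ∈ L
Unf-∈ closed m u-end = m
Unf-∈ closed m u-bra = m
Unf-∈ closed m u-sel = m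
Unf-∈ closed m (u-rec u) = Unf-∈ closed (closed m) u

branchSubterms-⊇ : ∀ {k} (ρ : Fin k → Ty 0) {bs l S T} → (l , S , T) ∈ bs →
                   subterms Env.[] S ⊆ branchSubterms ρ bs × subterms ρ T ⊆ branchSubterms ρ bs
branchSubterms-⊇ ρ {(_ , S , T) ∷ bs} (here refl) = ∈-++⁺ˡ , ∈-++⁺ʳ (subterms Env.[] S) ∘ ∈-++⁺ˡ
branchSubterms-⊇ ρ {(_ , S , T) ∷ bs} (there m) =
  ∈-++⁺ʳ (subterms Env.[] S) ∘ ∈-++⁺ʳ (subterms ρ T) ∘ proj₁ (branchSubterms-⊇ ρ m) ,
  ∈-++⁺ʳ (subterms Env.[] S) ∘ ∈-++⁺ʳ (subterms ρ T) ∘ proj₂ (branchSubterms-⊇ ρ m)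

∈-subBs⁻ : ∀ {k} (ρ : Fin k → Ty 0) bs {l S T} → (l , S , T) ∈ subBs ρ bs →
           ∃[ T′ ] ((l , S , T′) ∈ bs × T ≡ sub ρ T′)
∈-subBs⁻ ρ ((l , S , T) ∷ bs) (here refl) = T , here refl , refl
∈-subBs⁻ ρ (b ∷ bs) (there m) with ∈-subBs⁻ ρ bs m
... | T′ , m′ , e = T′ , there m′ , e

subBs-children : ∀ {k} (ρ : Fin k → Ty 0) bs {L} → branchSubterms ρ bs ⊆ L →
                 ∀ {l S T} → (l , S , T) ∈ subBs ρ bs → S ∈ L × T ∈ L
subBs-children ρ bs ⊆L m with ∈-subBs⁻ ρ bs m
... | T′ , m′ , refl =
  subst (_∈ _) (sub-closed Env.[] _) (⊆L (proj₁ (branchSubterms-⊇ ρ m′) (here refl))) ,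
  ⊆L (proj₂ (branchSubterms-⊇ ρ m′) (here refl))

rec-children : ∀ {k} (ρ : Fin k → Ty 0) (U : Ty (suc k)) {L} → subterms ρ (rec U) ⊆ L →
               ChildrenIn L (sub ρ (rec U))
rec-children ρ U ⊆L = subst (_∈ _) (sym (unfold-sub ρ U)) (⊆L (there (here refl)))

sub-children : ∀ {k} (ρ : Fin k → Ty 0) U {L} → subterms ρ U ⊆ L →
               (∀ x → ChildrenIn L (ρ x)) → ChildrenIn L (sub ρ U)
sub-children ρ end ⊆L ρ-children = tt
sub-children ρ (var x) ⊆L ρ-children = ρ-children x
sub-children ρ (rec U) ⊆L ρ-children = rec-children ρ U ⊆L
sub-children ρ (bra bs) ⊆L ρ-children = subBs-children ρ bs (⊆L ∘ there)
sub-children ρ (sel bs) ⊆L ρ-children = subBs-children ρ bs (⊆L ∘ there)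

mutual
  subterms-children : ∀ {k} (ρ : Fin k → Ty 0) U {L} → subterms ρ U ⊆ L →
                      (∀ x → ChildrenIn L (ρ x)) → ∀ {X} → X ∈ subterms ρ U → ChildrenIn L X
  subterms-children ρ U ⊆L ρ-children (here refl) = sub-children ρ U ⊆L ρ-children
  subterms-children ρ (rec U) {L} ⊆L ρ-children (there m) =
    subterms-children (sub ρ (rec U) Env.∷ ρ) U (⊆L ∘ there) children m
    where
      children : ∀ x → ChildrenIn L ((sub ρ (rec U) Env.∷ ρ) x)
      children zero = rec-children ρ U ⊆L
      children (suc x) = ρ-children x
  subterms-children ρ (bra bs) ⊆L ρ-children (there m) =
    branchSubterms-children ρ bs (⊆L ∘ there) ρ-children m
  subterms-children ρ (sel bs) ⊆L ρ-children (there m) =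
    branchSubterms-children ρ bs (⊆L ∘ there) ρ-children m

  branchSubterms-children : ∀ {k} (ρ : Fin k → Ty 0) bs {L} → branchSubterms ρ bs ⊆ L →
                            (∀ x → ChildrenIn L (ρ x)) →
                            ∀ {X} → X ∈ branchSubterms ρ bs → ChildrenIn L X
  branchSubterms-children ρ ((l , S , T) ∷ bs) ⊆L ρ-children m
    with ∈-++⁻ (subterms Env.[] S) m
  ... | inj₁ mS = subterms-children Env.[] S (⊆L ∘ ∈-++⁺ˡ) (λ ()) mS
  ... | inj₂ m′ with ∈-++⁻ (subterms ρ T) m′
  ... | inj₁ mT = subterms-children ρ T (⊆L ∘ ∈-++⁺ʳ (subterms Env.[] S) ∘ ∈-++⁺ˡ) ρ-children mT
  ... | inj₂ mbs = branchSubterms-children ρ bs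
                     (⊆L ∘ ∈-++⁺ʳ (subterms Env.[] S) ∘ ∈-++⁺ʳ (subterms ρ T)) ρ-children mbs

mutual
  subterms-WF : ∀ {k} (ρ : Fin k → Ty 0) U → (∀ x → WF (ρ x)) → WF U →
                ∀ {X} → X ∈ subterms ρ U → WF X
  subterms-WF ρ U wρ w (here refl) = WF-sub ρ wρ U w
  subterms-WF ρ (rec U) wρ w (there m) = subterms-WF (sub ρ (rec U) Env.∷ ρ) U wρ′ (proj₂ w) m
    where
      wρ′ : ∀ x → WF ((sub ρ (rec U) Env.∷ ρ) x)
      wρ′ zero = WF-sub ρ wρ (rec U) w
      wρ′ (suc x) = wρ x
  subterms-WF ρ (bra bs) wρ w (there m) = branchSubterms-WF ρ bs wρ (proj₂ w) m
  subterms-WF ρ (sel bs) wρ w (there m) = branchSubterms-WF ρ bs wρ (proj₂ w) m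

  branchSubterms-WF : ∀ {k} (ρ : Fin k → Ty 0) bs → (∀ x → WF (ρ x)) → WFBs bs →
                      ∀ {X} → X ∈ branchSubterms ρ bs → WF X
  branchSubterms-WF ρ ((l , S , T) ∷ bs) wρ (wS , wT , w) m with ∈-++⁻ (subterms Env.[] S) m
  ... | inj₁ mS = subterms-WF Env.[] S (λ ()) wS mS
  ... | inj₂ m′ with ∈-++⁻ (subterms ρ T) m′
  ... | inj₁ mT = subterms-WF ρ T wρ wT mT
  ... | inj₂ mbs = branchSubterms-WF ρ bs wρ w mbs

closure : Ty 0 → Ty 0 → List (Ty 0)
closure T S = subterms Env.[] T ++ subterms Env.[] S

closure-closed : ∀ T S → Closed (closure T S)
closure-closed T S m with ∈-++⁻ (subterms Env.[] T) m
... | inj₁ mT = subterms-children Env.[] T ∈-++⁺ˡ (λ ()) mT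
... | inj₂ mS = subterms-children Env.[] S (∈-++⁺ʳ (subterms Env.[] T)) (λ ()) mS

closure-WF : ∀ {T S} → WF T → WF S → ∀ {X} → X ∈ closure T S → WF X
closure-WF {T} {S} wT wS m with ∈-++⁻ (subterms Env.[] T) m
... | inj₁ mT = subterms-WF Env.[] T (λ ()) wT mT
... | inj₂ mS = subterms-WF Env.[] S (λ ()) wS mS

left∈closure : ∀ T S → T ∈ closure T S
left∈closure T S = ∈-++⁺ˡ {xs = subterms Env.[] T} (here (sym (sub-closed Env.[] T)))

right∈closure : ∀ T S → S ∈ closure T S
right∈closure T S = ∈-++⁺ʳ (subterms Env.[] T) (here (sym (sub-closed Env.[] S)))

module _ {A : Set} {P : A → Set} where

  count : ∀ {xs} → All (λ x → Dec (P x)) xs → ℕ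
  count [] = 0
  count (yes _ ∷ ds) = suc (count ds)
  count (no _ ∷ ds) = count ds

  count≤length : ∀ {xs} (ds : All (λ x → Dec (P x)) xs) → count ds ≤ length xs
  count≤length [] = z≤n
  count≤length (yes _ ∷ ds) = s≤s (count≤length ds)
  count≤length (no _ ∷ ds) = m≤n⇒m≤1+n (count≤length ds)

module _ {A : Set} {P Q : A → Set} (P⇒Q : ∀ {x} → P x → Q x) where

  count-mono : ∀ {xs} (P? : All (λ x → Dec (P x)) xs) (Q? : All (λ x → Dec (Q x)) xs) →
               count P? ≤ count Q?
  count-mono [] [] = z≤n
  count-mono (yes _ ∷ P?) (yes _ ∷ Q?) = s≤s (count-mono P? Q?)
  count-mono (yes p ∷ _) (no ¬q ∷ _) = ⊥-elim (¬q (P⇒Q p))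
  count-mono (no _ ∷ P?) (yes _ ∷ Q?) = m≤n⇒m≤1+n (count-mono P? Q?)
  count-mono (no _ ∷ P?) (no _ ∷ Q?) = count-mono P? Q?

  count-≡⇒Q⊆P : ∀ {xs} (P? : All (λ x → Dec (P x)) xs) (Q? : All (λ x → Dec (Q x)) xs) →
                count P? ≡ count Q? → ∀ {x} → x ∈ xs → Q x → P x
  count-≡⇒Q⊆P (yes p ∷ _) (yes _ ∷ _) _ (here refl) _ = p
  count-≡⇒Q⊆P (yes _ ∷ P?) (yes _ ∷ Q?) e (there m) q = count-≡⇒Q⊆P P? Q? (suc-injective e) m q
  count-≡⇒Q⊆P (yes p ∷ _) (no ¬q ∷ _) _ _ _ = ⊥-elim (¬q (P⇒Q p))
  count-≡⇒Q⊆P (no _ ∷ P?) (yes _ ∷ Q?) e _ _ = ⊥-elim (<-irrefl e (s≤s (count-mono P? Q?)))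
  count-≡⇒Q⊆P (no _ ∷ _) (no ¬q ∷ _) _ (here refl) q = ⊥-elim (¬q q)
  count-≡⇒Q⊆P (no _ ∷ P?) (no _ ∷ Q?) e (there m) q = count-≡⇒Q⊆P P? Q? e m q

-- The number of elements satisfying P k grows with k and is bounded by the
-- length of the list, so it cannot increase at every step.
stabilises : ∀ {A : Set} (xs : List A) (P : ℕ → A → Set) →
             (∀ k {x} → P k x → P (suc k) x) → (∀ k → All (λ x → Dec (P k x)) xs) →
             ∃[ k ] (∀ {x} → x ∈ xs → P (suc k) x → P k x)
stabilises xs P mono P? with stable-or-growing (suc (length xs))
  where
    c : ℕ → ℕ
    c k = count (P? k)

    stable-or-growing : ∀ n → (∃[ k ] c k ≡ c (suc k)) ⊎ n ≤ c n
    stable-or-growing zero = inj₂ z≤n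
    stable-or-growing (suc n) with stable-or-growing n
    ... | inj₁ stable = inj₁ stable
    ... | inj₂ n≤cn with c n ≟ c (suc n)
    ...   | yes e = inj₁ (n , e)
    ...   | no ≢ = inj₂ (≤-trans (s≤s n≤cn) (≤∧≢⇒< (count-mono (mono n) (P? n) (P? (suc n))) ≢))
... | inj₁ (k , e) = k , count-≡⇒Q⊆P (mono k) (P? k) (P? (suc k)) e
... | inj₂ n≤cn = ⊥-elim (<-irrefl refl (≤-trans n≤cn (count≤length (P? (suc (length xs))))))

HeadStep-within : ∀ {L R H₁ H₂} → ChildrenIn L H₁ → ChildrenIn L H₂ → HeadStep R H₁ H₂ →
                  HeadStep (λ X Y → X ∈ L × Y ∈ L × R X Y) H₁ H₂
HeadStep-within _ _ end≤end = end≤end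
HeadStep-within c c′ (bra≤bra cov) = bra≤bra within
  where
    within : Covered _ _ _ _
    within m′ with cov m′
    ... | S , T , m , p , q =
      S , T , m , (proj₁ (c m) , proj₁ (c′ m′) , p) , (proj₂ (c m) , proj₂ (c′ m′) , q)
HeadStep-within c c′ (sel≤sel cov) = sel≤sel within
  where
    within : Covered _ _ _ _
    within m with cov m
    ... | S , T , m′ , p , q =
      S , T , m′ , (proj₁ (c′ m′) , proj₁ (c m) , p) , (proj₂ (c m) , proj₂ (c′ m′) , q)

Unrefuted : List (Ty 0) → ℕ → Rel
Unrefuted L k X Y = X ∈ L × Y ∈ L × ¬ X ⋪[ k ] Y

Unrefuted-isSubRel : ∀ {L} k → Closed L → (∀ {X} → X ∈ L → WF X) →
                     (∀ {X Y} → X ∈ L → Y ∈ L → X ⋪[ suc k ] Y → X ⋪[ k ] Y) →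
                     IsSubRel (Unrefuted L k)
Unrefuted-isSubRel k closed wf stable (mX , mY , ¬r) with unfold _ (wf mX) | unfold _ (wf mY)
... | H₁ , u | H₂ , u′ =
  HeadStep⇒SubStep u u′
    (HeadStep-within (closed (Unf-∈ closed mX u)) (closed (Unf-∈ closed mY u′))
      (¬Clash⇒HeadStep (Unf-head u) (Unf-head u′) λ c → ¬r (stable mX mY (H₁ , H₂ , u , u′ , c))))

⋪s-complete : ∀ {T S} → WF T → WF S → ¬ T ≤s S → T ⋪s S
⋪s-complete {T} {S} wT wS ≰ with stabilises pairs (λ k (X , Y) → X ⋪[ k ] Y) (λ k → ⋪[]-mono k) decide
  where
    L : List (Ty 0)
    L = closure T S
    pairs : List (Ty 0 × Ty 0)
    pairs = cartesianProduct L L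
    decide : ∀ k → All (λ (X , Y) → Dec (X ⋪[ k ] Y)) pairs
    decide k = All.tabulate λ m → let mX , mY = ∈-cartesianProduct⁻ L L m in
                                  ⋪[ k ]? (closure-WF wT wS mX) (closure-WF wT wS mY)
... | k , stable with ⋪[ k ]? wT wS
...   | yes r = ⋪[]⇒⋪s k r
...   | no ¬r = ⊥-elim (≰ (Unrefuted (closure T S) k , simulation , left∈closure T S , right∈closure T S , ¬r))
  where
    simulation : IsSubRel (Unrefuted (closure T S) k)
    simulation = Unrefuted-isSubRel k (closure-closed T S) (closure-WF wT wS)
                                    (λ mX mY → stable (∈-cartesianProduct⁺ mX mY))

lemma3p3 : (T S : Ty 0) → WF T → WF S → ((¬ (T ≤s S)) ⇔ (T ⋪s S))
lemma3p3 T S wT wS = mk⇔ (⋪s-complete wT wS) λ r (R , isR , rTS) → ⋪s-sound isR rTS wT wS r
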